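{- Let $(H_n)_{n\in\omega}$ be countable discrete abelian groups and $G\le\prod_nH_n$ a closed subgroup. Let $p$ be a prime and $m\in\mathbb{N}_+$. Let $S\subseteq T_G$ be a group tree and $\sigma\in S\cap H^m$ an element whose order is a power of $p$. If $\omega\le r_S(\sigma)<\omega_1$ and $r_S(\sigma)$ is a limit ordinal, then $G_{\langle m\rangle}/G_{\langle m+1\rangle}$ is not $p$-compact.
   Context: A group $\Gamma$ is $p$-compact if for every decreasing sequence $(K_n)$ of subgroups of $\mathbb{Z}(p)\times\Gamma$ with $\pi[K_n]=\mathbb{Z}(p)$ for all $n$ ($\pi$ the projection to $\mathbb{Z}(p)$), we have $\pi[\bigcap_nK_n]=\mathbb{Z}(p)$. Let $\pi_k:\prod_nH_n\to H_k$ be the projections; $G_{\langle 0\rangle}=G$ and for $m\ge1$, $G_{\langle m\rangle}=\{x\in G:\pi_k(x)=0\text{ for all }k<m\}$. For $n\ge1$ let $H^n=H_0\times\cdots\times H_{n-1}$ (a group) and $T_H=\bigcup_{n\ge1}H^n$; for $\sigma\in H^n$, $\mathrm{lh}(\sigma)=n$; $\sigma\subseteq\tau$ means $\sigma$ is the restriction of $\tau$ to its first $\mathrm{lh}(\sigma)$ coordinates, similarly $\sigma\subseteq x$ for $x\in\prod_nH_n$. A tree is a subset of $T_H$ closed under restriction; $T_G=\{\sigma\in T_H:\exists x\in G\ \sigma\subseteq x\}$. A group tree is a tree $S$ with each $S\cap H^m$ ($m\ge1$) a subgroup of $H^m$. $D(S)=\{\sigma\in S:\exists\tau\in S\ (\sigma\subseteq\tau,\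 \mathrm{lh}(\sigma)<\mathrm{lh}(\tau))\}$; $D^0(S)=S$, $D^{\alpha+1}(S)=D(D^\alpha(S))$, $D^\lambda(S)=\bigcap_{\alpha<\lambda}D^\alpha(S)$ for limit $\lambda$. The rank $r_S(\sigma)$ of $\sigma\in S$ is the least $\alpha$ with $\sigma\in D^\alpha(S)\setminus D^{\alpha+1}(S)$ if such $\alpha$ exists, and $\omega_1$ otherwise. -}

module Defs where

open import Level using (0ℓ)
open import Algebra.Bundles using (AbelianGroup; RawGroup)
import Algebra.Properties.AbelianGroup as AGP
open import Data.Nat using (ℕ; zero; suc; _≤_; _<_; _^_)
open import Data.Nat.Properties using (<-≤-trans)
open import Data.Product using (Σ; ∃; _×_; _,_; proj₁; proj₂)
open import Data.Integer as ℤ using (ℤ)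
open import Data.Integer.Divisibility using () renaming (_∣_ to _∣ℤ_)

-- Countable (Brouwer) ordinals, used to index the Cantor–Bendixson-type
-- derivatives D^α.  Every Brouwer tree denotes a countable ordinal and
-- every countable ordinal is denoted by one.

data Ord : Set where
  ozero : Ord
  osuc  : Ord → Ord
  olim  : (ℕ → Ord) → Ord

data _≤o_ : Ord → Ord → Set where
  ≤o-zero      : ∀ {x} → ozero ≤o x
  ≤o-trans     : ∀ {x y z} → x ≤o y → y ≤o z → x ≤o z
  ≤o-succ-incr : ∀ {x} → x ≤o osuc x
  ≤o-succ-mono : ∀ {x y} → x ≤o y → osuc x ≤o osuc y
  ≤o-cocone    : ∀ {x} (f : ℕ → Ord) (k : ℕ) → x ≤o f k → x ≤o olim f
  ≤o-limiting  : ∀ {x} (f : ℕ → Ord) → (∀ k → f k ≤o x) → olim f ≤o x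

_<o_ : Ord → Ord → Set
x <o y = osuc x ≤o y

fromℕo : ℕ → Ord
fromℕo zero    = ozero
fromℕo (suc n) = osuc (fromℕo n)

ω : Ord
ω = olim fromℕo

Countable : AbelianGroup 0ℓ 0ℓ → Set
Countable A = Σ (ℕ → Carrier) λ e → ∀ x → ∃ λ k → e k ≈ x
  where open AbelianGroup A

-- ℤ(p) is represented by ℤ modulo the congruence  a ≡ b (mod p).
-- Subgroups of ℤ(p) × Γ for a group Γ (given by its raw operations
-- and its equality), and p-compactness.

record IsSubgroupZpΓ (p : ℕ) (Γ : RawGroup 0ℓ 0ℓ)
                     (K : ℤ × RawGroup.Carrier Γ → Set) : Set where
  open RawGroup Γ
  field
    resp : ∀ a b x y → (ℤ.+ p) ∣ℤ (a ℤ.- b) → x ≈ y → K (a , x) → K (b , y)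
    has0 : K (ℤ.0ℤ , ε)
    add  : ∀ a b x y → K (a , x) → K (b , y) → K (a ℤ.+ b , x ∙ y)
    neg  : ∀ a x → K (a , x) → K (ℤ.- a , x ⁻¹)

pCompact : ℕ → RawGroup 0ℓ 0ℓ → Set₁
pCompact p Γ =
  (K : ℕ → ℤ × RawGroup.Carrier Γ → Set) →
  (∀ n → IsSubgroupZpΓ p Γ (K n)) →
  (∀ n q → K (suc n) q → K n q) →
  (∀ n (a : ℤ) → ∃ λ γ → K n (a , γ)) →
  ∀ (a : ℤ) → ∃ λ γ → ∀ n → K n (a , γ)

module _ (H : ℕ → AbelianGroup 0ℓ 0ℓ) where

  C : ℕ → Set
  C n = AbelianGroup.Carrier (H n)

  Π : Set
  Π = (n : ℕ) → C n

  0Π : Π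
  0Π n = AbelianGroup.ε (H n)

  _+Π_ : Π → Π → Π
  (x +Π y) n = AbelianGroup._∙_ (H n) (x n) (y n)

  -Π_ : Π → Π
  (-Π x) n = AbelianGroup._⁻¹ (H n) (x n)

  record IsSubgroupΠ (G : Π → Set) : Set where
    field
      resp : ∀ x y → (∀ n → AbelianGroup._≈_ (H n) (x n) (y n)) → G x → G y
      has0 : G 0Π
      add  : ∀ x y → G x → G y → G (x +Π y)
      neg  : ∀ x → G x → G (-Π x)

  -- closed in the product of the discrete topologies
  IsClosed : (Π → Set) → Set
  IsClosed G = ∀ x →
    (∀ n → ∃ λ y → G y × (∀ i → i < n → AbelianGroup._≈_ (H i) (y i) (x i))) →
    G x

  G⟨_⟩ : (Π → Set) → ℕ → Π → Set
  G⟨ G ⟩ m x = G x × (∀ k → k < m → AbelianGroup._≈_ (H k) (x k) (AbelianGroup.ε (H k)))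

  Quot : (G : Π → Set) → IsSubgroupΠ G → ℕ → RawGroup 0ℓ 0ℓ
  Quot G sg m = record
    { Carrier = Σ Π (G⟨ G ⟩ m)
    ; _≈_     = λ x y → G⟨ G ⟩ (suc m) (proj₁ x +Π (-Π proj₁ y))
    ; _∙_     = λ x y → (proj₁ x +Π proj₁ y)
                      , IsSubgroupΠ.add sg _ _ (proj₁ (proj₂ x)) (proj₁ (proj₂ y))
                      , λ k k<m → let open AbelianGroup (H k) in
                          trans (∙-cong (proj₂ (proj₂ x) k k<m) (proj₂ (proj₂ y) k k<m))
                                (identityˡ ε)
    ; ε       = 0Π , IsSubgroupΠ.has0 sg , λ k _ → AbelianGroup.refl (H k)
    ; _⁻¹     = λ x → (-Π proj₁ x)
                    , IsSubgroupΠ.neg sg _ (proj₁ (proj₂ x))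
                    , λ k k<m → let open AbelianGroup (H k) in
                        trans (⁻¹-cong (proj₂ (proj₂ x) k k<m)) (AGP.ε⁻¹≈ε (H k))
    }

  Seq : ℕ → Set
  Seq m = (i : ℕ) → i < m → C i

  -- nodes of T_H (together with the empty sequence, excluded below)
  Node : Set
  Node = Σ ℕ Seq

  lh : Node → ℕ
  lh = proj₁

  _⊑_ : Node → Node → Set
  (n , σ) ⊑ (k , τ) = Σ (n ≤ k) λ n≤k →
    ∀ i (i<n : i < n) → AbelianGroup._≈_ (H i) (σ i i<n) (τ i (<-≤-trans i<n n≤k))

  _⊑Π_ : Node → Π → Set
  (n , σ) ⊑Π x = ∀ i (i<n : i < n) → AbelianGroup._≈_ (H i) (σ i i<n) (x i)

  0S : ∀ m → Seq m
  0S m i _ = AbelianGroup.ε (H i)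

  _+S_ : ∀ {m} → Seq m → Seq m → Seq m
  (σ +S τ) i h = AbelianGroup._∙_ (H i) (σ i h) (τ i h)

  -S_ : ∀ {m} → Seq m → Seq m
  (-S σ) i h = AbelianGroup._⁻¹ (H i) (σ i h)

  _·S_ : ∀ {m} → ℕ → Seq m → Seq m
  zero  ·S σ = 0S _
  suc k ·S σ = σ +S (k ·S σ)

  _≈S_ : ∀ {m} → Seq m → Seq m → Set
  σ ≈S τ = ∀ i h → AbelianGroup._≈_ (H i) (σ i h) (τ i h)

  T⟨_⟩ : (Π → Set) → Node → Set
  T⟨ G ⟩ σ = 1 ≤ lh σ × ∃ λ x → G x × σ ⊑Π x

  record IsGroupTree (S : Node → Set) : Set where
    field
      inTH     : ∀ σ → S σ → 1 ≤ lh σ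
      restrict : ∀ σ τ → 1 ≤ lh σ → σ ⊑ τ → S τ → S σ
      has0     : ∀ m → 1 ≤ m → S (m , 0S m)
      add      : ∀ m → 1 ≤ m → (σ τ : Seq m) → S (m , σ) → S (m , τ) → S (m , σ +S τ)
      neg      : ∀ m → 1 ≤ m → (σ : Seq m) → S (m , σ) → S (m , -S σ)

  D : (Node → Set) → Node → Set
  D S σ = S σ × ∃ λ τ → S τ × σ ⊑ τ × lh σ < lh τ

  D^ : Ord → (Node → Set) → Node → Set
  D^ ozero    S = S
  D^ (osuc α) S = D (D^ α S)
  D^ (olim f) S σ = ∀ n → D^ (f n) S σ

module Submission where

open import Defs
open import Level using (0ℓ)
open import Algebra.Bundles using (AbelianGroup; RawGroup)
import Algebra.Properties.AbelianGroup as AbelianGroupProperties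
import Algebra.Properties.CommutativeMonoid.Mult as Mult
import Algebra.Properties.CommutativeSemigroup as CommutativeSemigroupProperties
open import Data.Nat using (ℕ; zero; suc; _∸_; _≤_; _<_; _^_; s≤s; z≤n; pred; NonZero)
import Data.Nat as ℕ
import Data.Nat.Properties as ℕ
import Data.Nat.Divisibility as ℕ
open import Data.Nat.Primality using (Prime; prime⇒nonZero)
open import Data.Integer using (ℤ; +_; ∣_∣)
import Data.Integer.Properties as ℤ
open import Data.Integer.DivMod using (_%ℕ_; _/ℕ_; a≡a%ℕn+[a/ℕn]*n)
open import Data.Integer.Divisibility.Signed
  using (_∣_; divides; ∣⇒∣ᵤ; ∣ᵤ⇒∣; ∣m∣n⇒∣m-n; ∣m∣n⇒∣m+n; ∣m⇒∣-m; ∣m⇒∣m*n; ∣-refl)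
open import Data.Integer.Tactic.RingSolver using (solve-∀)
open import Data.Product using (Σ; ∃; _×_; _,_; proj₁; proj₂)
open import Data.Sum using (inj₁; inj₂)
open import Function using (_∘_)
open import Relation.Nullary using (¬_)
open import Relation.Binary.PropositionalEquality as ≡ using (_≡_; subst)

-- Put λ = sup f and X n = D^(f n)(S).  As σ ∈ X (n + 1) ⊆ D(X n), σ has a one-point extension
-- σ⌢c n in X n.  The x with 0⌢x ∈ X n form a descending chain N of subgroups of H_m inside
-- π_m[G⟨m⟩]; (c n) is Cauchy for N, and p^k · c n ∈ N n because p^k σ = 0.  p-compactness of
-- G⟨m⟩/G⟨m+1⟩ says that such sequences in π_m[G⟨m⟩] converge; this passes from p to p^k, and
-- moving each c n inside its coset of N n removes the need for c n itself to lie in π_m[G⟨m⟩].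
-- A limit e gives σ⌢e ∈ ⋂ X n = D^λ(S), so σ ∈ D^(λ+1)(S), contradicting r_S(σ) = λ.

module IntegerCongruence (p : ℕ) where

  open import Data.Integer using (_+_; _-_; -_; _*_)

  infix 4 _≡ₚ_
  _≡ₚ_ : ℤ → ℤ → Set
  a ≡ₚ b = + p ∣ a - b

  ≡ₚ-refl : ∀ a → a ≡ₚ a
  ≡ₚ-refl a = divides (+ 0) (ℤ.+-inverseʳ a)

  ≡ₚ-sym : ∀ a b → a ≡ₚ b → b ≡ₚ a
  ≡ₚ-sym a b a≡b = subst (+ p ∣_) (eq a b) (∣m⇒∣-m a≡b)
    where eq : ∀ a b → - (a - b) ≡ b - a
          eq = solve-∀

  ≡ₚ-trans : ∀ a b c → a ≡ₚ b → b ≡ₚ c → a ≡ₚ c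
  ≡ₚ-trans a b c a≡b b≡c = subst (+ p ∣_) (eq a b c) (∣m∣n⇒∣m+n a≡b b≡c)
    where eq : ∀ a b c → (a - b) + (b - c) ≡ a - c
          eq = solve-∀

  ≡ₚ-+ : ∀ a b j k → a ≡ₚ + j → b ≡ₚ + k → a + b ≡ₚ + (j ℕ.+ k)
  ≡ₚ-+ a b j k a≡j b≡k =
    subst (+ p ∣_) (≡.trans (eq a b (+ j) (+ k)) (≡.cong (λ z → a + b - z) (≡.sym (ℤ.pos-+ j k))))
          (∣m∣n⇒∣m+n a≡j b≡k)
    where eq : ∀ a b j k → (a - j) + (b - k) ≡ (a + b) - (j + k)
          eq = solve-∀

  -- pred p * j represents - a because j + pred p * j = p * j.
  ≡ₚ-neg : .{{_ : NonZero p}} → ∀ a j → a ≡ₚ + j → - a ≡ₚ + (pred p ℕ.* j)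
  ≡ₚ-neg a j a≡j = subst (+ p ∣_) (≡.sym eq) (∣m∣n⇒∣m-n (∣m⇒∣-m a≡j) (∣m⇒∣m*n (+ j) ∣-refl))
    where
    j′ = pred p ℕ.* j
    open ≡.≡-Reasoning
    ring : ∀ a j j′ → - a - j′ ≡ - (a - j) - (j + j′)
    ring = solve-∀
    eq : - a - + j′ ≡ - (a - + j) - + p * + j
    eq = begin
      - a - + j′                             ≡⟨ ring a (+ j) (+ j′) ⟩
      - (a - + j) - (+ j + + j′)             ≡⟨ ≡.cong (λ z → - (a - + j) - z) (≡.sym (ℤ.pos-+ j j′)) ⟩
      - (a - + j) - + (suc (pred p) ℕ.* j)   ≡⟨ ≡.cong (λ n → - (a - + j) - + (n ℕ.* j)) (ℕ.suc-pred p) ⟩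
      - (a - + j) - + (p ℕ.* j)              ≡⟨ ≡.cong (λ z → - (a - + j) - z) (ℤ.pos-* p j) ⟩
      - (a - + j) - + p * + j                ∎

  ≡ₚ-%ℕ : .{{_ : NonZero p}} → ∀ a → a ≡ₚ + (a %ℕ p)
  ≡ₚ-%ℕ a = divides (a /ℕ p) (≡.trans (≡.cong (_- + (a %ℕ p)) (a≡a%ℕn+[a/ℕn]*n a p))
                                       (eq (+ (a %ℕ p)) ((a /ℕ p) * + p)))
    where eq : ∀ r s → (r + s) - r ≡ s
          eq = solve-∀

  ≡ₚ⇒∣∸ : ∀ {a b} → a ≤ b → + a ≡ₚ + b → p ℕ.∣ b ∸ a
  ≡ₚ⇒∣∸ {a} {b} a≤b a≡b =
    subst (p ℕ.∣_) (≡.trans (≡.cong ∣_∣ (ℤ.m-n≡m⊖n a b)) (ℤ.∣⊖∣-≤ a≤b)) (∣⇒∣ᵤ a≡b)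

module AbelianGroupTheory (A : AbelianGroup 0ℓ 0ℓ) where

  open AbelianGroup A
  open AbelianGroupProperties A public
  open CommutativeSemigroupProperties commutativeSemigroup using (interchange)
  open Mult commutativeMonoid public
    using (×-congʳ; ×-homo-1; ×-homo-+; ×-assocˡ; ×-distrib-+)
    renaming (_×_ to _·_)
  open import Relation.Binary.Reasoning.Setoid setoid

  [x-y]∙[y-z]≈x-z : ∀ x y z → (x - y) ∙ (y - z) ≈ x - z
  [x-y]∙[y-z]≈x-z x y z = begin
    (x - y) ∙ (y - z)       ≈⟨ ∙-congʳ (comm x (y ⁻¹)) ⟩
    (y ⁻¹ ∙ x) ∙ (y - z)    ≈⟨ interchange _ _ _ _ ⟩
    (y ⁻¹ ∙ y) ∙ (x - z)    ≈⟨ ∙-congʳ (inverseˡ y) ⟩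
    ε ∙ (x - z)             ≈⟨ identityˡ _ ⟩
    x - z                   ∎

  [x∙y]-[u∙v]≈[x-u]∙[y-v] : ∀ x y u v → (x ∙ y) - (u ∙ v) ≈ (x - u) ∙ (y - v)
  [x∙y]-[u∙v]≈[x-u]∙[y-v] x y u v = begin
    (x ∙ y) - (u ∙ v)         ≈⟨ ∙-congˡ (⁻¹-∙-comm u v) ⟨
    (x ∙ y) ∙ (u ⁻¹ ∙ v ⁻¹)   ≈⟨ interchange _ _ _ _ ⟩
    (x - u) ∙ (y - v)         ∎

  x-ε≈x : ∀ x → x - ε ≈ x
  x-ε≈x x = trans (∙-congˡ ε⁻¹≈ε) (identityʳ x)

  x⁻¹-y⁻¹≈y-x : ∀ x y → x ⁻¹ - y ⁻¹ ≈ y - x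
  x⁻¹-y⁻¹≈y-x x y = trans (∙-congˡ (⁻¹-involutive y)) (comm _ _)

  x∙[y-x]≈y : ∀ x y → x ∙ (y - x) ≈ y
  x∙[y-x]≈y x y = trans (sym (assoc _ _ _)) (xyx⁻¹≈y x y)

  ·-ε : ∀ k → k · ε ≈ ε
  ·-ε zero    = refl
  ·-ε (suc k) = trans (identityˡ _) (·-ε k)

  ·-⁻¹ : ∀ k x → k · (x ⁻¹) ≈ (k · x) ⁻¹
  ·-⁻¹ zero    x = sym ε⁻¹≈ε
  ·-⁻¹ (suc k) x = trans (∙-congˡ (·-⁻¹ k x)) (⁻¹-∙-comm _ _)

  ·-distrib-‿- : ∀ k x y → k · (x - y) ≈ k · x - k · y
  ·-distrib-‿- k x y = trans (×-distrib-+ x (y ⁻¹) k) (∙-congˡ (·-⁻¹ k y))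

  [a*b]·x≈b·a·x : ∀ a b x → (a ℕ.* b) · x ≈ b · a · x
  [a*b]·x≈b·a·x a b x = trans (reflexive (≡.cong (_· x) (ℕ.*-comm a b))) (sym (×-assocˡ x b a))

  record IsSubgroup (P : Carrier → Set) : Set where
    field
      resp : ∀ {x y} → x ≈ y → P x → P y
      has0 : P ε
      add  : ∀ {x y} → P x → P y → P (x ∙ y)
      neg  : ∀ {x} → P x → P (x ⁻¹)

    sub : ∀ {x y} → P x → P y → P (x - y)
    sub Px Py = add Px (neg Py)

    mul : ∀ k {x} → P x → P (k · x)
    mul zero    Px = has0
    mul (suc k) Px = add Px (mul k Px)

    infix 4 _∼_
    _∼_ : Carrier → Carrier → Set
    x ∼ y = P (x - y)

    ∼-reflexive : ∀ {x y} → x ≈ y → x ∼ y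
    ∼-reflexive x≈y = resp (sym (x≈y⇒x∙y⁻¹≈ε x≈y)) has0

    ∼-refl : ∀ {x} → x ∼ x
    ∼-refl = ∼-reflexive refl

    ∼-sym : ∀ {x y} → x ∼ y → y ∼ x
    ∼-sym {x} {y} x∼y = resp (⁻¹-anti-homo‿- x y) (neg x∼y)

    ∼-trans : ∀ {x y z} → x ∼ y → y ∼ z → x ∼ z
    ∼-trans {x} {y} {z} x∼y y∼z = resp ([x-y]∙[y-z]≈x-z x y z) (add x∼y y∼z)

    ∙-cong-∼ : ∀ {x y u v} → x ∼ u → y ∼ v → x ∙ y ∼ u ∙ v
    ∙-cong-∼ {x} {y} {u} {v} x∼u y∼v = resp (sym ([x∙y]-[u∙v]≈[x-u]∙[y-v] x y u v)) (add x∼u y∼v)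

    ⁻¹-cong-∼ : ∀ {x y} → x ∼ y → x ⁻¹ ∼ y ⁻¹
    ⁻¹-cong-∼ {x} {y} x∼y = resp (sym (x⁻¹-y⁻¹≈y-x x y)) (∼-sym x∼y)

    ·-cong-∼ : ∀ k {x y} → x ∼ y → k · x ∼ k · y
    ·-cong-∼ zero    x∼y = ∼-refl
    ·-cong-∼ (suc k) x∼y = ∙-cong-∼ x∼y (·-cong-∼ k x∼y)

    ∈⇒∼ε : ∀ {x} → P x → x ∼ ε
    ∈⇒∼ε {x} Px = resp (sym (x-ε≈x x)) Px

  module _ {p : ℕ} {P : Carrier → Set} (isSubgroupP : IsSubgroup P)
           {c : Carrier} (pc∈P : P (p · c)) where

    open IsSubgroup isSubgroupP
    open IntegerCongruence p

    ·-cong-∣∸ : ∀ {a b} → a ≤ b → p ℕ.∣ b ∸ a → b · c ∼ a · c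
    ·-cong-∣∸ {a} {b} a≤b (ℕ.divides s b∸a≡s*p) = resp (sym b·c-a·c≈[b∸a]·c) [b∸a]·c∈P
      where
      [b∸a]·c∈P : P ((b ∸ a) · c)
      [b∸a]·c∈P = resp (trans (×-assocˡ c s p) (reflexive (≡.cong (_· c) (≡.sym b∸a≡s*p)))) (mul s pc∈P)
      b·c-a·c≈[b∸a]·c : b · c - a · c ≈ (b ∸ a) · c
      b·c-a·c≈[b∸a]·c = trans (∙-congʳ (trans (reflexive (≡.cong (_· c) (≡.sym (ℕ.m+[n∸m]≡n a≤b))))
                                                (×-homo-+ c a (b ∸ a))))
                              (xyx⁻¹≈y _ _)

    ·-cong-≡ₚ : ∀ a b → + a ≡ₚ + b → a · c ∼ b · c
    ·-cong-≡ₚ a b a≡b with ℕ.≤-total a b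
    ... | inj₁ a≤b = ∼-sym (·-cong-∣∸ a≤b (≡ₚ⇒∣∸ a≤b a≡b))
    ... | inj₂ b≤a = ·-cong-∣∸ b≤a (≡ₚ⇒∣∸ b≤a (≡ₚ-sym (+ a) (+ b) a≡b))

    ⁻¹-∼-pred : .{{_ : NonZero p}} → ∀ j → (j · c) ⁻¹ ∼ (pred p ℕ.* j) · c
    ⁻¹-∼-pred j = resp (sym (⁻¹-∙-comm (j · c) ((pred p ℕ.* j) · c))) (neg (resp e (mul j pc∈P)))
      where
      e : j · p · c ≈ j · c ∙ (pred p ℕ.* j) · c
      e = trans (sym ([a*b]·x≈b·a·x p j c))
          (trans (reflexive (≡.cong (λ n → (n ℕ.* j) · c) (≡.sym (ℕ.suc-pred p))))
                 (×-homo-+ c j (pred p ℕ.* j)))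

  ∩-isSubgroup : ∀ {P R} → IsSubgroup P → IsSubgroup R → IsSubgroup (λ x → P x × R x)
  ∩-isSubgroup sP sR = record
    { resp = λ e (p , r) → P.resp e p , R.resp e r
    ; has0 = P.has0 , R.has0
    ; add  = λ (p , r) (p′ , r′) → P.add p p′ , R.add r r′
    ; neg  = λ (p , r) → P.neg p , R.neg r }
    where module P = IsSubgroup sP
          module R = IsSubgroup sR

  kernel-isSubgroup : ∀ q → IsSubgroup (λ x → q · x ≈ ε)
  kernel-isSubgroup q = record
    { resp = λ e qx≈ε → trans (×-congʳ q (sym e)) qx≈ε
    ; has0 = ·-ε q
    ; add  = λ {x} {y} qx≈ε qy≈ε → trans (×-distrib-+ x y q) (trans (∙-cong qx≈ε qy≈ε) (identityˡ ε))
    ; neg  = λ {x} qx≈ε → trans (·-⁻¹ q x) (trans (⁻¹-cong qx≈ε) ε⁻¹≈ε) }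

  preimage-isSubgroup : ∀ q {P} → IsSubgroup P → IsSubgroup (λ x → P (q · x))
  preimage-isSubgroup q sP = record
    { resp = λ e → resp (×-congʳ q e)
    ; has0 = resp (sym (·-ε q)) has0
    ; add  = λ {x} {y} Pqx Pqy → resp (sym (×-distrib-+ x y q)) (add Pqx Pqy)
    ; neg  = λ {x} Pqx → resp (sym (·-⁻¹ q x)) (neg Pqx) }
    where open IsSubgroup sP

  image-isSubgroup : ∀ q {P} → IsSubgroup P → IsSubgroup (λ x → ∃ λ a → P a × x ≈ q · a)
  image-isSubgroup q sP = record
    { resp = λ e (a , Pa , x≈qa) → a , Pa , trans (sym e) x≈qa
    ; has0 = ε , has0 , sym (·-ε q)
    ; add  = λ (a , Pa , x≈qa) (b , Pb , y≈qb) →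
               a ∙ b , add Pa Pb , trans (∙-cong x≈qa y≈qb) (sym (×-distrib-+ a b q))
    ; neg  = λ (a , Pa , x≈qa) → a ⁻¹ , neg Pa , trans (⁻¹-cong x≈qa) (sym (·-⁻¹ q a)) }
    where open IsSubgroup sP

  record SubgroupChain : Set₁ where
    field
      member     : ℕ → Carrier → Set
      isSubgroup : ∀ n → IsSubgroup (member n)
      descending : ∀ n {x} → member (suc n) x → member n x

    member⇒member₀ : ∀ n {x} → member n x → member 0 x
    member⇒member₀ zero    x∈ = x∈
    member⇒member₀ (suc n) x∈ = member⇒member₀ n (descending n x∈)

  open SubgroupChain

  module At (B : SubgroupChain) (n : ℕ) = IsSubgroup (isSubgroup B n)

  Cauchy : SubgroupChain → (ℕ → Carrier) → Set
  Cauchy B c = ∀ n → member B n (c (suc n) - c n)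

  Limit : SubgroupChain → (ℕ → Carrier) → Carrier → Set
  Limit B c h = ∀ n → member B n (h - c n)

  preimage : ℕ → SubgroupChain → SubgroupChain
  preimage q B = record
    { member     = λ n x → member B n (q · x)
    ; isSubgroup = λ n → preimage-isSubgroup q (isSubgroup B n)
    ; descending = λ n → descending B n }

  image : ℕ → SubgroupChain → SubgroupChain
  image q B = record
    { member     = λ n x → ∃ λ a → member B n a × x ≈ q · a
    ; isSubgroup = λ n → image-isSubgroup q (isSubgroup B n)
    ; descending = λ n (a , a∈ , x≈qa) → a , descending B n a∈ , x≈qa }

  _∩kernel_ : SubgroupChain → ℕ → SubgroupChain
  B ∩kernel q = record
    { member     = λ n x → member B n x × q · x ≈ ε
    ; isSubgroup = λ n → ∩-isSubgroup (isSubgroup B n) (kernel-isSubgroup q)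
    ; descending = λ n (x∈ , qx≈ε) → descending B n x∈ , qx≈ε }

  module _ {Q : Carrier → Set} (isSubgroupQ : IsSubgroup Q) where

    private module Q = IsSubgroup isSubgroupQ

    Complete : ℕ → Set₁
    Complete q = (B : SubgroupChain) (c : ℕ → Carrier) → (∀ n → Q (c n)) → Cauchy B c →
                 (∀ n → member B n (q · c n)) → ∃ λ h → Q h × Limit B c h

    complete-1 : Complete 1
    complete-1 B c _ _ c∈B = ε , Q.has0 , λ n →
      At.resp B n (sym (identityˡ _)) (At.neg B n (At.resp B n (×-homo-1 (c n)) (c∈B n)))

    complete-* : ∀ {a b} → Complete a → Complete b → Complete (a ℕ.* b)
    complete-* {a} {b} completeA completeB B c c∈Q cauchy abc∈B =
      x ∙ y , Q.add x∈Q y∈Q , λ n →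
        At.∼-trans B n (At.∙-cong-∼ B n (At.∼-refl B n) (y-d n)) (At.∼-reflexive B n (x∙[y-x]≈y x (c n)))
      where
      limA = completeA (preimage b B) c c∈Q
        (λ n → At.mul B n b (cauchy n))
        (λ n → At.resp B n ([a*b]·x≈b·a·x a b (c n)) (abc∈B n))
      x = proj₁ limA
      x∈Q = proj₁ (proj₂ limA)
      d : ℕ → Carrier
      d n = c n - x
      limB = completeB B d (λ n → Q.sub (c∈Q n) x∈Q)
        (λ n → At.∙-cong-∼ B n (cauchy n) (At.∼-refl B n))
        (λ n → At.resp B n (trans (sym (·-⁻¹ b _)) (×-congʳ b (⁻¹-anti-homo‿- x (c n))))
                 (At.neg B n (proj₂ (proj₂ limA) n)))
      y = proj₁ limB
      y∈Q = proj₁ (proj₂ limB)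
      y-d = proj₂ (proj₂ limB)

    complete-^ : ∀ {p} → Complete p → ∀ k → Complete (p ^ k)
    complete-^     completeP zero    = complete-1
    complete-^ {p} completeP (suc k) = complete-* {p} {p ^ k} completeP (complete-^ completeP k)

    module _ {q : ℕ} (completeQ : Complete q)
             (N : SubgroupChain) (N⊆Q : ∀ {x} → member N 0 x → Q x) where

      cauchy⇒∼₀ : ∀ {c} → Cauchy N c → ∀ n → member N 0 (c n - c 0)
      cauchy⇒∼₀ cauchy zero    = At.∼-refl N 0
      cauchy⇒∼₀ cauchy (suc n) = At.∼-trans N 0 (member⇒member₀ N n (cauchy n)) (cauchy⇒∼₀ cauchy n)

      constant-multiple : ∀ {c} → Cauchy N c → (∀ n → member N n (q · c n)) →
        Σ (ℕ → Carrier) λ e → (∀ n → member N n (e n - c n)) × (∀ n → q · e n ≈ q · e 0)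
      constant-multiple {c} cauchy qc∈N = e , e∼c , λ n → trans (qe≈x n) (sym (qe≈x 0))
        where
        lim = completeQ (image q N) (λ n → q · c n) (λ n → N⊆Q (member⇒member₀ N n (qc∈N n)))
          (λ n → c (suc n) - c n , cauchy n , sym (·-distrib-‿- q _ _))
          (λ n → q · c n , qc∈N n , refl)
        x = proj₁ lim
        a : ℕ → Carrier
        a n = proj₁ (proj₂ (proj₂ lim) n)
        a∈N : ∀ n → member N n (a n)
        a∈N n = proj₁ (proj₂ (proj₂ (proj₂ lim) n))
        x-qc≈qa : ∀ n → x - q · c n ≈ q · a n
        x-qc≈qa n = proj₂ (proj₂ (proj₂ (proj₂ lim) n))
        e : ℕ → Carrier
        e n = c n ∙ a n
        e∼c : ∀ n → member N n (e n - c n)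
        e∼c n = At.∼-trans N n (At.∙-cong-∼ N n (At.∼-refl N n) (At.∈⇒∼ε N n (a∈N n)))
                               (At.∼-reflexive N n (identityʳ (c n)))
        qe≈x : ∀ n → q · e n ≈ x
        qe≈x n = trans (×-distrib-+ (c n) (a n) q) (trans (∙-congˡ (sym (x-qc≈qa n))) (x∙[y-x]≈y _ x))

      limit-of-constant-multiple : ∀ {e} → Cauchy N e → (∀ n → q · e n ≈ q · e 0) → ∃ λ h → Limit N e h
      limit-of-constant-multiple {e} cauchy qe≈qe₀ = e 0 ∙ v , λ n →
          At.∼-trans N n (At.∙-cong-∼ N n (At.∼-refl N n) (proj₁ (v∼u n)))
                         (At.∼-reflexive N n (x∙[y-x]≈y (e 0) (e n)))
        where
        u : ℕ → Carrier
        u n = e n - e 0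
        qu≈ε : ∀ n → q · u n ≈ ε
        qu≈ε n = trans (·-distrib-‿- q _ _) (x≈y⇒x∙y⁻¹≈ε (qe≈qe₀ n))
        lim = completeQ (N ∩kernel q) u (λ n → N⊆Q (cauchy⇒∼₀ cauchy n))
          (λ n → At.∙-cong-∼ N n (cauchy n) (At.∼-refl N n) ,
                 IsSubgroup.sub (kernel-isSubgroup q) (qu≈ε (suc n)) (qu≈ε n))
          (λ n → At.resp N n (sym (qu≈ε n)) (At.has0 N n) , trans (×-congʳ q (qu≈ε n)) (·-ε q))
        v = proj₁ lim
        v∼u = proj₂ (proj₂ lim)

      complete⇒limit : ∀ {c} → Cauchy N c → (∀ n → member N n (q · c n)) → ∃ λ h → Limit N c h
      complete⇒limit {c} cauchy qc∈N = h , λ n → At.∼-trans N n (h∼e n) (e∼c n)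
        where
        correction = constant-multiple cauchy qc∈N
        e = proj₁ correction
        e∼c = proj₁ (proj₂ correction)
        cauchyE : Cauchy N e
        cauchyE n = At.∼-trans N n (N.descending n (e∼c (suc n)))
                      (At.∼-trans N n (cauchy n) (At.∼-sym N n (e∼c n)))
          where module N = SubgroupChain N
        lim = limit-of-constant-multiple cauchyE (proj₂ (proj₂ correction))
        h = proj₁ lim
        h∼e = proj₂ lim

module Compactness (H : ℕ → AbelianGroup 0ℓ 0ℓ) (G : Π H → Set) (sg : IsSubgroupΠ H G) (m : ℕ) where

  open AbelianGroup (H m)
  open AbelianGroupTheory (H m)
  open SubgroupChain
  private
    Γ = Quot H G sg m
    module Γ = RawGroup Γ

  Q : Carrier → Set
  Q x = Σ Γ.Carrier λ γ → proj₁ γ m ≈ x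

  isSubgroupQ : IsSubgroup Q
  isSubgroupQ = record
    { resp = λ x≈y (γ , γ≈x) → γ , trans γ≈x x≈y
    ; has0 = Γ.ε , refl
    ; add  = λ (γ , γ≈x) (δ , δ≈y) → γ Γ.∙ δ , ∙-cong γ≈x δ≈y
    ; neg  = λ (γ , γ≈x) → γ Γ.⁻¹ , ⁻¹-cong γ≈x }

  pCompact⇒complete : ∀ p .{{_ : NonZero p}} → pCompact p Γ → Complete isSubgroupQ p
  pCompact⇒complete p compact B c c∈Q cauchy pc∈B = proj₁ γ m , (γ , refl) , γ∼c
    where
    open IntegerCongruence p

    -- K n relates a ∈ ℤ(p) to the δ with δ(m) ≡ a · c n modulo B n (well defined as p · c n ∈ B n);
    -- an element of ⋂ K over a = 1 is the required limit.
    K : ℕ → ℤ × Γ.Carrier → Set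
    K n (a , δ) = ∃ λ j → a ≡ₚ + j × member B n (proj₁ δ m - j · c n)

    isSubgroupK : ∀ n → IsSubgroupZpΓ p Γ (K n)
    isSubgroupK n = record
      { resp = λ a b δ δ′ p∣a-b δ≈δ′ (j , a≡j , δ∼jc) →
          j , ≡ₚ-trans b a (+ j) (≡ₚ-sym a b (∣ᵤ⇒∣ p∣a-b)) a≡j ,
          ∼-trans (∼-reflexive (sym (x∙y⁻¹≈ε⇒x≈y _ _ (proj₂ δ≈δ′ m (ℕ.n<1+n m))))) δ∼jc
      ; has0 = 0 , ≡ₚ-refl (+ 0) , ∼-refl
      ; add  = λ a b δ δ′ (j , a≡j , δ∼jc) (k , b≡k , δ′∼kc) →
          j ℕ.+ k , ≡ₚ-+ a b j k a≡j b≡k ,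
          ∼-trans (∙-cong-∼ δ∼jc δ′∼kc) (∼-reflexive (sym (×-homo-+ (c n) j k)))
      ; neg  = λ a δ (j , a≡j , δ∼jc) →
          pred p ℕ.* j , ≡ₚ-neg a j a≡j ,
          ∼-trans (⁻¹-cong-∼ δ∼jc) (⁻¹-∼-pred (isSubgroup B n) (pc∈B n) j) }
      where open IsSubgroup (isSubgroup B n)

    descendingK : ∀ n x → K (suc n) x → K n x
    descendingK n x (j , a≡j , δ∼jc) =
      j , a≡j , ∼-trans (descending B n δ∼jc) (·-cong-∼ j (cauchy n))
      where open IsSubgroup (isSubgroup B n)

    surjectiveK : ∀ n a → ∃ λ δ → K n (a , δ)
    surjectiveK n a = δ , a %ℕ p , ≡ₚ-%ℕ a , IsSubgroup.∼-reflexive (isSubgroup B n) δ≈jc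
      where
      open IsSubgroup isSubgroupQ using (mul)
      δ = proj₁ (mul (a %ℕ p) (c∈Q n))
      δ≈jc = proj₂ (mul (a %ℕ p) (c∈Q n))

    γ∈⋂K = compact K isSubgroupK descendingK surjectiveK (+ 1)
    γ = proj₁ γ∈⋂K

    γ∼c : ∀ n → member B n (proj₁ γ m - c n)
    γ∼c n with proj₂ γ∈⋂K n
    ... | j , 1≡j , γ∼jc =
      ∼-trans γ∼jc (∼-trans (·-cong-≡ₚ (isSubgroup B n) (pc∈B n) j 1 (≡ₚ-sym (+ 1) (+ j) 1≡j))
                            (∼-reflexive (×-homo-1 (c n))))
      where open IsSubgroup (isSubgroup B n)

module Trees (H : ℕ → AbelianGroup 0ℓ 0ℓ) where

  private
    module Hᵢ (i : ℕ) where
      open AbelianGroup (H i) public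
      open AbelianGroupTheory (H i) public using (_·_)

  seq-irrelevant : ∀ {k} (s : Seq H k) {i} (h h′ : i < k) → Hᵢ._≈_ i (s i h) (s i h′)
  seq-irrelevant s {i} h h′ = Hᵢ.reflexive i (≡.cong (s i) (ℕ.<-irrelevant h h′))

  ⊑-trans : ∀ {σ τ ρ} → _⊑_ H σ τ → _⊑_ H τ ρ → _⊑_ H σ ρ
  ⊑-trans {n , σ} {k , τ} {l , ρ} (n≤k , σ⊑τ) (k≤l , τ⊑ρ) = ℕ.≤-trans n≤k k≤l , λ i i<n →
    Hᵢ.trans i (σ⊑τ i i<n) (Hᵢ.trans i (τ⊑ρ i (ℕ.<-≤-trans i<n n≤k)) (seq-irrelevant ρ _ _))

  ≈S⇒⊑ : ∀ {k} {σ τ : Seq H k} → _≈S_ H σ τ → _⊑_ H (k , σ) (k , τ)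
  ≈S⇒⊑ {σ = σ} {τ} σ≈τ = ℕ.≤-refl , λ i h → Hᵢ.trans i (σ≈τ i h) (seq-irrelevant τ _ _)

  infix 4 _≋_⌢_
  record _≋_⌢_ {m} (ρ : Seq H (suc m)) (σ : Seq H m) (x : C H m) : Set where
    constructor _,_
    field
      prefix : ∀ i (h : i < m) → Hᵢ._≈_ i (σ i h) (ρ i (ℕ.m<n⇒m<1+n h))
      last   : Hᵢ._≈_ m (ρ m (ℕ.n<1+n m)) x

  module _ {m : ℕ} where

    ≋⌢-⊑ : ∀ {ρ σ x} → ρ ≋ σ ⌢ x → _⊑_ H (m , σ) (suc m , ρ)
    ≋⌢-⊑ {ρ} (σ≈ρ , _) = ℕ.n≤1+n m , λ i h → Hᵢ.trans i (σ≈ρ i h) (seq-irrelevant ρ _ _)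

    ≋⌢-unique : ∀ {ρ ρ′ : Seq H (suc m)} {σ x} → ρ ≋ σ ⌢ x → ρ′ ≋ σ ⌢ x → _≈S_ H ρ ρ′
    ≋⌢-unique {ρ} {ρ′} (σ≈ρ , ρₘ≈x) (σ≈ρ′ , ρ′ₘ≈x) i h with ℕ.m<1+n⇒m<n∨m≡n h
    ... | inj₁ i<m    = Hᵢ.trans i (seq-irrelevant ρ _ _) (Hᵢ.trans i (Hᵢ.sym i (σ≈ρ i i<m))
                          (Hᵢ.trans i (σ≈ρ′ i i<m) (seq-irrelevant ρ′ _ _)))
    ... | inj₂ ≡.refl = Hᵢ.trans i (seq-irrelevant ρ _ _) (Hᵢ.trans i ρₘ≈x
                          (Hᵢ.trans i (Hᵢ.sym i ρ′ₘ≈x) (seq-irrelevant ρ′ _ _)))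

    ≋⌢-resp : ∀ {ρ σ σ′ x x′} → _≈S_ H σ σ′ → Hᵢ._≈_ m x x′ → ρ ≋ σ ⌢ x → ρ ≋ σ′ ⌢ x′
    ≋⌢-resp σ≈σ′ x≈x′ (σ≈ρ , ρₘ≈x) =
      (λ i h → Hᵢ.trans i (Hᵢ.sym i (σ≈σ′ i h)) (σ≈ρ i h)) , Hᵢ.trans m ρₘ≈x x≈x′

    ≋⌢-+S : ∀ {ρ ρ′ σ σ′ x x′} → ρ ≋ σ ⌢ x → ρ′ ≋ σ′ ⌢ x′ →
            _+S_ H ρ ρ′ ≋ _+S_ H σ σ′ ⌢ Hᵢ._∙_ m x x′
    ≋⌢-+S (σ≈ρ , ρₘ≈x) (σ′≈ρ′ , ρ′ₘ≈x′) =
      (λ i h → Hᵢ.∙-cong i (σ≈ρ i h) (σ′≈ρ′ i h)) , Hᵢ.∙-cong m ρₘ≈x ρ′ₘ≈x′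

    ≋⌢-negS : ∀ {ρ σ x} → ρ ≋ σ ⌢ x → -S_ H ρ ≋ -S_ H σ ⌢ Hᵢ._⁻¹ m x
    ≋⌢-negS (σ≈ρ , ρₘ≈x) = (λ i h → Hᵢ.⁻¹-cong i (σ≈ρ i h)) , Hᵢ.⁻¹-cong m ρₘ≈x

    ≋⌢-·S : ∀ q {ρ σ x} → ρ ≋ σ ⌢ x → _·S_ H q ρ ≋ _·S_ H q σ ⌢ Hᵢ._·_ m q x
    ≋⌢-·S zero    _     = (λ i h → Hᵢ.refl i) , Hᵢ.refl m
    ≋⌢-·S (suc q) ρ≋σ⌢x = ≋⌢-+S ρ≋σ⌢x (≋⌢-·S q ρ≋σ⌢x)

    0S≋0S⌢ε : _≋_⌢_ (0S H (suc m)) (0S H m) (Hᵢ.ε m)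
    0S≋0S⌢ε = (λ i h → Hᵢ.refl i) , Hᵢ.refl m

  ⋂ : (ℕ → Node H → Set) → Node H → Set
  ⋂ X σ = ∀ n → X n σ

  infix 4 _⌢_∈_
  record _⌢_∈_ {m} (σ : Seq H m) (x : C H m) (X : Node H → Set) : Set where
    constructor successor
    field
      ρ      : Seq H (suc m)
      ρ∈X    : X (suc m , ρ)
      ρ≋σ⌢x : ρ ≋ σ ⌢ x

  module _ {m : ℕ} where

    ⌢∈-resp : ∀ {X σ σ′ x x′} → _≈S_ H σ σ′ → Hᵢ._≈_ m x x′ → σ ⌢ x ∈ X → σ′ ⌢ x′ ∈ X
    ⌢∈-resp σ≈σ′ x≈x′ (successor ρ Xρ ρ≋σ⌢x) = successor ρ Xρ (≋⌢-resp σ≈σ′ x≈x′ ρ≋σ⌢x)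

    ⌢∈-mono : ∀ {X Y : Node H → Set} {σ : Seq H m} {x} → (∀ {τ} → X τ → Y τ) → σ ⌢ x ∈ X → σ ⌢ x ∈ Y
    ⌢∈-mono X⊆Y (successor ρ Xρ ρ≋σ⌢x) = successor ρ (X⊆Y Xρ) ρ≋σ⌢x

    D⇒⌢∈ : ∀ {X σ} → IsGroupTree H X → D H X (m , σ) → ∃ λ x → σ ⌢ x ∈ X
    D⇒⌢∈ isGroupTree (_ , (k , τ) , Xτ , (m≤k , σ⊑τ) , m<k) =
      ρ m (ℕ.n<1+n m) ,
      successor ρ (IsGroupTree.restrict isGroupTree (suc m , ρ) (k , τ) (s≤s z≤n) ρ⊑τ Xτ)
                  ((λ i h → Hᵢ.trans i (σ⊑τ i h) (seq-irrelevant τ _ _)) , Hᵢ.refl m)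
      where
      ρ : Seq H (suc m)
      ρ i h = τ i (ℕ.<-≤-trans h m<k)
      ρ⊑τ : _⊑_ H (suc m , ρ) (k , τ)
      ρ⊑τ = m<k , λ i h → Hᵢ.refl i

    ⌢∈⇒D : ∀ {X σ x} → X (m , σ) → σ ⌢ x ∈ X → D H X (m , σ)
    ⌢∈⇒D Xσ (successor ρ Xρ ρ≋σ⌢x) = Xσ , (suc m , ρ) , Xρ , ≋⌢-⊑ ρ≋σ⌢x , ℕ.n<1+n m

  module _ {X : Node H → Set} (isGroupTree : IsGroupTree H X) where

    open IsGroupTree isGroupTree

    ∈-resp-≈S : ∀ {k} {σ τ : Seq H k} → _≈S_ H σ τ → X (k , σ) → X (k , τ)
    ∈-resp-≈S {k} {σ} {τ} σ≈τ Xσ =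
      restrict (k , τ) (k , σ) (inTH _ Xσ) (≈S⇒⊑ (λ i h → Hᵢ.sym i (σ≈τ i h))) Xσ

    ·S-closed : ∀ {k} q {σ : Seq H k} → 1 ≤ k → X (k , σ) → X (k , _·S_ H q σ)
    ·S-closed zero    1≤k Xσ = has0 _ 1≤k
    ·S-closed (suc q) 1≤k Xσ = add _ 1≤k _ _ Xσ (·S-closed q 1≤k Xσ)

    module _ {m : ℕ} where

      ⌢∈-+S : ∀ {σ σ′ x x′} → σ ⌢ x ∈ X → σ′ ⌢ x′ ∈ X → _+S_ H σ σ′ ⌢ Hᵢ._∙_ m x x′ ∈ X
      ⌢∈-+S (successor ρ Xρ ρ≋σ⌢x) (successor ρ′ Xρ′ ρ′≋σ′⌢x′) =
        successor _ (add (suc m) (s≤s z≤n) ρ ρ′ Xρ Xρ′) (≋⌢-+S ρ≋σ⌢x ρ′≋σ′⌢x′)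

      ⌢∈-negS : ∀ {σ x} → σ ⌢ x ∈ X → -S_ H σ ⌢ Hᵢ._⁻¹ m x ∈ X
      ⌢∈-negS (successor ρ Xρ ρ≋σ⌢x) = successor _ (neg (suc m) (s≤s z≤n) ρ Xρ) (≋⌢-negS ρ≋σ⌢x)

      ⌢∈-·S : ∀ q {σ x} → σ ⌢ x ∈ X → _·S_ H q σ ⌢ Hᵢ._·_ m q x ∈ X
      ⌢∈-·S q (successor ρ Xρ ρ≋σ⌢x) = successor _ (·S-closed q (s≤s z≤n) Xρ) (≋⌢-·S q ρ≋σ⌢x)

      0S⌢ε∈ : 0S H m ⌢ Hᵢ.ε m ∈ X
      0S⌢ε∈ = successor (0S H (suc m)) (has0 (suc m) (s≤s z≤n)) 0S≋0S⌢ε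

  fibre-isSubgroup : ∀ {X m} → IsGroupTree H X →
                     AbelianGroupTheory.IsSubgroup (H m) (λ x → 0S H m ⌢ x ∈ X)
  fibre-isSubgroup {m = m} isGroupTree = record
    { resp = ⌢∈-resp (λ i h → Hᵢ.refl i)
    ; has0 = 0S⌢ε∈ isGroupTree
    ; add  = λ 0⌢x∈X 0⌢y∈X →
        ⌢∈-resp (λ i h → Hᵢ.identityˡ i _) (Hᵢ.refl m) (⌢∈-+S isGroupTree 0⌢x∈X 0⌢y∈X)
    ; neg  = λ 0⌢x∈X →
        ⌢∈-resp (λ i h → AbelianGroupTheory.ε⁻¹≈ε (H i)) (Hᵢ.refl m) (⌢∈-negS isGroupTree 0⌢x∈X) }

  ⋂-isGroupTree : ∀ {X} → (∀ n → IsGroupTree H (X n)) → IsGroupTree H (⋂ X)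
  ⋂-isGroupTree isGroupTree = record
    { inTH     = λ σ ⋂Xσ → inTH 0 σ (⋂Xσ 0)
    ; restrict = λ σ τ 1≤σ σ⊑τ ⋂Xτ n → restrict n σ τ 1≤σ σ⊑τ (⋂Xτ n)
    ; has0     = λ m 1≤m n → has0 n m 1≤m
    ; add      = λ m 1≤m σ τ ⋂Xσ ⋂Xτ n → add n m 1≤m σ τ (⋂Xσ n) (⋂Xτ n)
    ; neg      = λ m 1≤m σ ⋂Xσ n → neg n m 1≤m σ (⋂Xσ n) }
    where open module X n = IsGroupTree (isGroupTree n)

  ⌢∈-⋂ : ∀ {X m} {σ : Seq H m} {x} → (∀ n → IsGroupTree H (X n)) → (∀ n → σ ⌢ x ∈ X n) → σ ⌢ x ∈ ⋂ X
  ⌢∈-⋂ {X} isGroupTree σ⌢x∈X = successor ρ₀ ρ₀∈⋂X ρ₀≋σ⌢x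
    where
    open _⌢_∈_ (σ⌢x∈X 0) using () renaming (ρ to ρ₀; ρ≋σ⌢x to ρ₀≋σ⌢x)
    ρ₀∈⋂X : ⋂ X (_ , ρ₀)
    ρ₀∈⋂X n = ∈-resp-≈S (isGroupTree n) (≋⌢-unique ρ≋σ⌢x ρ₀≋σ⌢x) ρ∈X
      where open _⌢_∈_ (σ⌢x∈X n)

  D-isGroupTree : ∀ {X} → IsGroupTree H X → IsGroupTree H (D H X)
  D-isGroupTree {X} isGroupTree = record
    { inTH     = λ σ DXσ → inTH σ (proj₁ DXσ)
    ; restrict = λ { σ τ 1≤σ σ⊑τ (Xτ , τ′ , Xτ′ , τ⊑τ′ , τ<τ′) →
        restrict σ τ 1≤σ σ⊑τ Xτ , τ′ , Xτ′ ,
        ⊑-trans {σ} {τ} {τ′} σ⊑τ τ⊑τ′ , ℕ.≤-<-trans (proj₁ σ⊑τ) τ<τ′ }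
    ; has0     = λ m 1≤m → ⌢∈⇒D (has0 m 1≤m) (0S⌢ε∈ isGroupTree)
    ; add      = λ m 1≤m σ τ DXσ DXτ → ⌢∈⇒D (add m 1≤m σ τ (proj₁ DXσ) (proj₁ DXτ))
        (⌢∈-+S isGroupTree (proj₂ (D⇒⌢∈ isGroupTree DXσ)) (proj₂ (D⇒⌢∈ isGroupTree DXτ)))
    ; neg      = λ m 1≤m σ DXσ → ⌢∈⇒D (neg m 1≤m σ (proj₁ DXσ))
        (⌢∈-negS isGroupTree (proj₂ (D⇒⌢∈ isGroupTree DXσ))) }
    where open IsGroupTree isGroupTree

  D^-isGroupTree : ∀ {S} α → IsGroupTree H S → IsGroupTree H (D^ H α S)
  D^-isGroupTree ozero    isGroupTree = isGroupTree
  D^-isGroupTree (osuc α) isGroupTree = D-isGroupTree (D^-isGroupTree α isGroupTree)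
  D^-isGroupTree (olim f) isGroupTree = ⋂-isGroupTree (λ n → D^-isGroupTree (f n) isGroupTree)

  D^⊆ : ∀ {S} α {σ} → D^ H α S σ → S σ
  D^⊆ ozero    Sσ  = Sσ
  D^⊆ (osuc α) DSσ = D^⊆ α (proj₁ DSσ)
  D^⊆ (olim f) DSσ = D^⊆ (f 0) (DSσ 0)

  D-mono : ∀ {X Y : Node H → Set} → (∀ {σ} → X σ → Y σ) → ∀ {σ} → D H X σ → D H Y σ
  D-mono X⊆Y (Xσ , τ , Xτ , σ⊑τ , σ<τ) = X⊆Y Xσ , τ , X⊆Y Xτ , σ⊑τ , σ<τ

  D^-antitone : ∀ {S α β} → α ≤o β → ∀ {σ} → D^ H β S σ → D^ H α S σ
  D^-antitone {β = β} ≤o-zero         = D^⊆ β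
  D^-antitone (≤o-trans α≤β β≤γ)      = D^-antitone α≤β ∘ D^-antitone β≤γ
  D^-antitone ≤o-succ-incr            = proj₁
  D^-antitone (≤o-succ-mono α≤β)      = D-mono (D^-antitone α≤β)
  D^-antitone (≤o-cocone f k α≤fk) Dσ = D^-antitone α≤fk (Dσ k)
  D^-antitone (≤o-limiting f fk≤α) Dσ = λ k → D^-antitone (fk≤α k) Dσ

module LimitRank (H : ℕ → AbelianGroup 0ℓ 0ℓ) (G : Π H → Set) (sg : IsSubgroupΠ H G) (m : ℕ) where

  open AbelianGroup (H m)
  open AbelianGroupTheory (H m)
  open SubgroupChain using (member)
  open Compactness H G sg m
  open Trees H

  ⌢∈T⇒∈Q : ∀ {X x} → (∀ τ → X τ → T⟨_⟩ H G τ) → 0S H m ⌢ x ∈ X → Q x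
  ⌢∈T⇒∈Q X⊆T (successor ρ ρ∈X (0≈ρ , ρₘ≈x)) with X⊆T _ ρ∈X
  ... | _ , y , y∈G , ρ⊑y =
    (y , y∈G , λ i i<m → AbelianGroup.sym (H i) (AbelianGroup.trans (H i) (0≈ρ i i<m) (ρ⊑y i _))) ,
    trans (sym (ρ⊑y m _)) ρₘ≈x

  torsion∈⋂⇒∈D⋂ : ∀ p .{{_ : NonZero p}} → pCompact p (Quot H G sg m) →
    (X : ℕ → Node H → Set) → (∀ n → IsGroupTree H (X n)) → (∀ n τ → X n τ → T⟨_⟩ H G τ) →
    (∀ n {τ} → X (suc n) τ → D H (X n) τ) →
    (σ : Seq H m) → (∃ λ k → _≈S_ H (_·S_ H (p ^ k) σ) (0S H m)) →
    ⋂ X (m , σ) → D H (⋂ X) (m , σ)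
  torsion∈⋂⇒∈D⋂ p compact X isGroupTree X⊆T X-step σ (k , pᵏσ≈0) σ∈⋂X =
    ⌢∈⇒D σ∈⋂X (⌢∈-⋂ isGroupTree σ⌢e∈X)
    where
    σ⌢c∈X : ∀ n → ∃ λ x → σ ⌢ x ∈ X n
    σ⌢c∈X n = D⇒⌢∈ (isGroupTree n) (X-step n (σ∈⋂X (suc n)))
    c : ℕ → Carrier
    c n = proj₁ (σ⌢c∈X n)

    X-descending : ∀ n {τ} → X (suc n) τ → X n τ
    X-descending n = proj₁ ∘ X-step n

    N : SubgroupChain
    N = record
      { member     = λ n x → 0S H m ⌢ x ∈ X n
      ; isSubgroup = λ n → fibre-isSubgroup (isGroupTree n)
      ; descending = λ n → ⌢∈-mono (X-descending n) }

    cauchy : Cauchy N c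
    cauchy n = ⌢∈-resp (λ i h → AbelianGroup.inverseʳ (H i) _) refl
      (⌢∈-+S (isGroupTree n) (⌢∈-mono (X-descending n) (proj₂ (σ⌢c∈X (suc n))))
                             (⌢∈-negS (isGroupTree n) (proj₂ (σ⌢c∈X n))))

    torsion : ∀ n → member N n ((p ^ k) · c n)
    torsion n = ⌢∈-resp pᵏσ≈0 refl (⌢∈-·S (isGroupTree n) (p ^ k) (proj₂ (σ⌢c∈X n)))

    completeᵏ = complete-^ isSubgroupQ {p} (pCompact⇒complete p compact) k
    limit = complete⇒limit isSubgroupQ {p ^ k} completeᵏ N (⌢∈T⇒∈Q (X⊆T 0)) cauchy torsion
    e = proj₁ limit

    σ⌢e∈X : ∀ n → σ ⌢ e ∈ X n
    σ⌢e∈X n = ⌢∈-resp (λ i h → AbelianGroup.identityʳ (H i) _) (x∙[y-x]≈y (c n) e)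
      (⌢∈-+S (isGroupTree n) (proj₂ (σ⌢c∈X n)) (proj₂ limit n))

lemma4p5 : (H : ℕ → AbelianGroup 0ℓ 0ℓ) → (∀ n → Countable (H n)) →
    (G : Π H → Set) → (sg : IsSubgroupΠ H G) → IsClosed H G →
    (p : ℕ) → Prime p → (m : ℕ) → 1 ≤ m →
    (S : Node H → Set) → IsGroupTree H S → (∀ τ → S τ → T⟨_⟩ H G τ) →
    (σ : Seq H m) → S (m , σ) →
    (∃ λ k → _≈S_ H (_·S_ H (p ^ k) σ) (0S H m)) →
    (f : ℕ → Ord) → (∀ n → f n <o f (suc n)) → ω ≤o olim f →
    D^ H (olim f) S (m , σ) → ¬ D^ H (osuc (olim f)) S (m , σ) →
    ¬ pCompact p (Quot H G sg m)
lemma4p5 H _ G sg _ p p-prime m _ S isGroupTree S⊆T σ _ torsion f f-increasing _ σ∈Dλ σ∉Dλ+1 compact =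
  σ∉Dλ+1 (torsion∈⋂⇒∈D⋂ p ⦃ prime⇒nonZero p-prime ⦄ compact (λ n → D^ H (f n) S)
            (λ n → D^-isGroupTree (f n) isGroupTree) (λ n τ → S⊆T τ ∘ D^⊆ (f n))
            (λ n → D^-antitone (f-increasing n)) σ torsion σ∈Dλ)
  where open LimitRank H G sg m
        open Trees H
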